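{- Let $n\ge 1$ and $c\ge 1$ be integers and let $k$ be a non-negative integer. Then the number of colored Lehmer codes $\ell=(\ell_1,\dots,\ell_n)$ with $0\le \ell_i< c\cdot i$ for all $i$ and $\ell_1+\cdots+\ell_n=k$ equals $i_c(n,k)$.
   Context: For integers $n\ge1$, $c\ge1$, let $G_{c,n}$ be the set of colored permutations: words $\sigma=\sigma_1^{[c_1]}\sigma_2^{[c_2]}\cdots\sigma_n^{[c_n]}$ where $|\sigma|:=\sigma_1\sigma_2\cdots\sigma_n$ is a permutation of $[n]=\{1,\dots,n\}$ (the underlying permutation) and each color $c_i=\mathrm{col}(\sigma_i)\in\{0,1,\dots,c-1\}$; thus $|G_{c,n}|=c^n n!$. For a permutation $\pi$ of $[n]$, $\mathrm{inv}(\pi)=|\{(i,j):i<j,\ \pi_i>\pi_j\}|$. Set $\mathrm{col}(\sigma)=c_1+\cdots+c_n$ and define the colored inversion number $\mathrm{inv}_c(\sigma)=\mathrm{inv}(|\sigma|)+\mathrm{col}(\sigma)+c\cdot|\{(i,j):1\le i<j\le n,\ \sigma_i<\sigma_j,\ c_j\neq 0\}|$. The colored Mahonian number is $i_c(n,k)=|\{\sigma\in G_{c,n}:\mathrm{inv}_c(\sigma)=k\}|$. A colored Lehmer code of length $n$ (with parameter $c$) is an $n$-tuple of integers $(\ell_1,\dots,\ell_n)$ with $0\le\ell_i<c\cdot i$ for each $i$. -}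

module Defs where

open import Data.Nat using (ℕ; zero; suc; _+_; _*_; _<ᵇ_)
open import Data.Bool using (Bool; true; false; _∧_; not; if_then_else_; T)
open import Data.Fin using (Fin; toℕ)
open import Data.Vec using (Vec; []; _∷_; sum)
open import Data.Product using (Σ; _×_)
open import Relation.Binary.PropositionalEquality using (_≡_)

-- Convention: the letter j ∈ [n] is represented by (j - 1) : Fin n;
-- this shift preserves the order, hence inversions etc.

_∈ᵇ_ : ∀ {m k} → Fin m → Vec (Fin m) k → Bool
x ∈ᵇ [] = false
x ∈ᵇ (y ∷ ys) = (toℕ x Data.Nat.≡ᵇ toℕ y) Data.Bool.∨ (x ∈ᵇ ys)

distinct : ∀ {m k} → Vec (Fin m) k → Bool
distinct [] = true
distinct (x ∷ xs) = not (x ∈ᵇ xs) ∧ distinct xs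

-- A word of length n over [n] with distinct letters = a permutation of [n].
IsPerm : ∀ {n} → Vec (Fin n) n → Set
IsPerm w = T (distinct w)

record ColPerm (c n : ℕ) : Set where
  constructor colperm
  field
    word   : Vec (Fin n) n
    colors : Vec (Fin c) n
    isPerm : IsPerm word

[_] : Bool → ℕ
[ b ] = if b then 1 else 0

pairTerm : ∀ {c n} → Fin n → Fin n → Fin c → ℕ
pairTerm {c} x y cy =
  [ toℕ y <ᵇ toℕ x ] + c * [ (toℕ x <ᵇ toℕ y) ∧ (0 <ᵇ toℕ cy) ]

pairsWith : ∀ {c n k} → Fin n → Vec (Fin n) k → Vec (Fin c) k → ℕ
pairsWith x [] [] = 0
pairsWith x (y ∷ ys) (cy ∷ cys) = pairTerm x y cy + pairsWith x ys cys

pairSum : ∀ {c n k} → Vec (Fin n) k → Vec (Fin c) k → ℕ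
pairSum [] [] = 0
pairSum (x ∷ xs) (_ ∷ cs) = pairsWith x xs cs + pairSum xs cs

-- inv(|σ|) + c·#{i<j : σ_i < σ_j, c_j ≠ 0}
pairPart : ∀ {c n k} → Vec (Fin n) k → Vec (Fin c) k → ℕ
pairPart = pairSum

colSum : ∀ {c k} → Vec (Fin c) k → ℕ
colSum [] = 0
colSum (x ∷ xs) = toℕ x + colSum xs

invc : ∀ {c n} → ColPerm c n → ℕ
invc (colperm w cs _) = pairPart w cs + colSum cs

-- The set {σ ∈ G_{c,n} : inv_c(σ) = k}; i_c(n,k) is its cardinality.
InvClass : ℕ → ℕ → ℕ → Set
InvClass c n k = Σ (ColPerm c n) (λ σ → invc σ ≡ k)

-- Bounds check: ℓ_i < c·i, where the first entry of the vector has index i = start.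
boundsFrom : ∀ {k} → ℕ → ℕ → Vec ℕ k → Bool
boundsFrom c i [] = true
boundsFrom c i (l ∷ ls) = (l <ᵇ c * i) ∧ boundsFrom c (suc i) ls

IsLehmer : ∀ {n} → ℕ → Vec ℕ n → Set
IsLehmer c ℓ = T (boundsFrom c 1 ℓ)

LehmerClass : ℕ → ℕ → ℕ → Set
LehmerClass c n k = Σ (Vec ℕ n) (λ ℓ → IsLehmer c ℓ × sum ℓ ≡ k)

{-# OPTIONS --safe #-}
-- Both sides are built one step at a time. A colored Lehmer code of length n + 1 is a code of
-- length n followed by a last entry v < c(n + 1). A colored permutation of [n + 1] is one of [n]
-- into which the letter n + 1 has been inserted at some position p ∈ {0, …, n} with some color t:
-- the new letter is an inversion with each of the n − p letters after it and, when t ≠ 0, adds c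
-- for each of the p letters before it, so inv_c grows by (n − p) + c·p·[t ≠ 0] + t. The map
-- (p, t) ↦ (n − p) + c·p·[t ≠ 0] + t is a bijection onto {0, …, c(n + 1) − 1} (color 0 gives
-- 0, …, n; color s + 1 gives n + 1 + (c − 1)·p + s), so induction on n yields a bijection between
-- codes and colored permutations carrying the sum of the code to inv_c.
module Submission where

open import Defs
open import Data.Nat using (ℕ; _≤_)
open import Function.Bundles using (_↔_)

open import Algebra.Bundles using (CommutativeMonoid)
open import Algebra.Properties.CommutativeSemigroup using (x∙yz≈y∙xz)
open import Data.Bool using (true; false; _∧_; _∨_; not; T)
open import Data.Bool.Properties
  using (T-∧; T-not-≡; T-irrelevant; ∧-identityʳ; ∧-assoc; ∧-commutativeMonoid; ∨-commutativeMonoid)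
open import Data.Empty using (⊥-elim)
open import Data.Fin
  using (Fin; zero; suc; toℕ; fromℕ; fromℕ<; inject₁; lower₁; opposite; cast; combine; remQuot; splitAt;
         _↑ˡ_; _↑ʳ_)
open import Data.Fin.Properties
  using (toℕ<n; toℕ-injective; toℕ-fromℕ; toℕ-fromℕ<; fromℕ<-toℕ; toℕ-inject₁; inject₁-injective;
         fromℕ≢inject₁; inject₁-lower₁; toℕ-↑ˡ; toℕ-↑ʳ; toℕ-cast; toℕ-combine; opposite-prop;
         opposite-involutive; cast-involutive; splitAt-↑ˡ; splitAt-↑ʳ; splitAt⁻¹-↑ˡ; splitAt⁻¹-↑ʳ;
         remQuot-combine; combine-remQuot)
open import Data.Nat using (zero; suc; _+_; _*_; _∸_; _<_; _<ᵇ_; _≡ᵇ_)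
open import Data.Nat.Properties
  using (≡ᵇ⇒≡; ≡⇒≡ᵇ; <ᵇ⇒<; <⇒<ᵇ; <ᵇ-reflects-<; <-asym; ≤-pred; ≡-irrelevant; +-identityʳ; +-suc;
         +-assoc; +-comm; *-comm; *-zeroʳ; m+[n∸m]≡n; +-commutativeSemigroup)
open import Data.Nat.Tactic.RingSolver using (solve-∀)
open import Data.Product using (Σ; Σ-syntax; ∃; ∃₂; _×_; _,_; proj₁; proj₂; map₂; uncurry)
open import Data.Product.Algebra using (Σ-assoc)
open import Data.Product.Function.Dependent.Propositional using (Σ-↔)
open import Data.Product.Function.NonDependent.Propositional using (_×-↔_)
open import Data.Sum using (inj₁; inj₂)
open import Data.Unit using (tt)
open import Data.Vec using (Vec; []; _∷_; sum; map; insertAt; removeAt; lookup; _∷ʳ_; init; last; initLast)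
open import Data.Vec.Properties
  using (∷-injective; init-∷ʳ; last-∷ʳ; insertAt-lookup; removeAt-insertAt; insertAt-removeAt)
open import Function using (_∘_)
open import Function.Bundles using (Inverse; Equivalence; _⇔_; mk↔ₛ′)
open import Function.Properties.Inverse using (↔-sym; ↔-trans)
open import Relation.Nullary using (¬_)
open import Relation.Nullary.Reflects using (Reflects; ofʸ; ofⁿ; fromEquivalence)
open import Relation.Binary.PropositionalEquality
  using (_≡_; _≢_; refl; sym; trans; cong; cong₂; subst; module ≡-Reasoning)
open ≡-Reasoning

private variable
  A B C D : Set
  wA : A → ℕ
  wB : B → ℕ
  wC : C → ℕ
  wD : D → ℕ
  c k m n : ℕ

+-leftComm : ∀ x y z → x + (y + z) ≡ y + (x + z)
+-leftComm = x∙yz≈y∙xz +-commutativeSemigroup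

∨-leftComm : ∀ x y z → x ∨ (y ∨ z) ≡ y ∨ (x ∨ z)
∨-leftComm = x∙yz≈y∙xz (CommutativeMonoid.commutativeSemigroup ∨-commutativeMonoid)

∧-leftComm : ∀ x y z → x ∧ (y ∧ z) ≡ y ∧ (x ∧ z)
∧-leftComm = x∙yz≈y∙xz (CommutativeMonoid.commutativeSemigroup ∧-commutativeMonoid)

Σ-≡-irrelevant : {P : A → Set} → (∀ {a} (p q : P a) → p ≡ q) →
                 {x y : Σ A P} → proj₁ x ≡ proj₁ y → x ≡ y
Σ-≡-irrelevant irr {a , p} {.a , q} refl = cong (a ,_) (irr p q)

record WeightedIso {A B : Set} (wA : A → ℕ) (wB : B → ℕ) : Set where
  field
    iso       : A ↔ B
    weight-to : ∀ a → wB (Inverse.to iso a) ≡ wA a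

  weight-from : ∀ b → wA (Inverse.from iso b) ≡ wB b
  weight-from b = trans (sym (weight-to (Inverse.from iso b))) (cong wB (Inverse.strictlyInverseˡ iso b))

open WeightedIso

infixr 4 _⨾ʷ_
infixr 5 _×ʷ_

symʷ : WeightedIso wA wB → WeightedIso wB wA
symʷ e = record { iso = ↔-sym (iso e) ; weight-to = weight-from e }

_⨾ʷ_ : WeightedIso wA wB → WeightedIso wB wC → WeightedIso wA wC
e ⨾ʷ f = record { iso = ↔-trans (iso e) (iso f) ; weight-to = λ a → trans (weight-to f _) (weight-to e a) }

_×ʷ_ : WeightedIso wA wB → WeightedIso wC wD →
       WeightedIso (λ z → wA (proj₁ z) + wC (proj₂ z)) (λ z → wB (proj₁ z) + wD (proj₂ z))
e ×ʷ f = record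
  { iso       = iso e ×-↔ iso f
  ; weight-to = λ z → cong₂ _+_ (weight-to e (proj₁ z)) (weight-to f (proj₂ z))
  }

fibre-↔ : WeightedIso wA wB → ∀ k → Σ A (λ a → wA a ≡ k) ↔ Σ B (λ b → wB b ≡ k)
fibre-↔ e k = Σ-↔ (iso e) λ {a} →
  mk↔ₛ′ (trans (weight-to e a)) (trans (sym (weight-to e a)))
        (λ _ → ≡-irrelevant _ _) (λ _ → ≡-irrelevant _ _)

Below : ℕ → Set
Below m = Σ ℕ (λ v → T (v <ᵇ m))

below↔Fin : ∀ m → WeightedIso {Below m} proj₁ (toℕ {m})
below↔Fin m = record
  { iso       = mk↔ₛ′ (λ v → fromℕ< (<ᵇ⇒< _ m (proj₂ v))) (λ i → toℕ i , <⇒<ᵇ (toℕ<n i))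
                      (λ i → fromℕ<-toℕ i _) (λ v → Σ-≡-irrelevant T-irrelevant (toℕ-fromℕ< _))
  ; weight-to = λ v → toℕ-fromℕ< _
  }

Lehmer : ℕ → ℕ → Set
Lehmer c n = Σ (Vec ℕ n) (IsLehmer c)

sum-∷ʳ : ∀ (xs : Vec ℕ n) v → sum (xs ∷ʳ v) ≡ sum xs + v
sum-∷ʳ []       v = +-identityʳ v
sum-∷ʳ (x ∷ xs) v = trans (cong (x +_) (sum-∷ʳ xs v)) (sym (+-assoc x (sum xs) v))

boundsFrom-∷ʳ : ∀ c i (xs : Vec ℕ n) v → boundsFrom c i (xs ∷ʳ v) ≡ boundsFrom c i xs ∧ (v <ᵇ c * (i + n))
boundsFrom-∷ʳ c i []       v rewrite +-identityʳ i = ∧-identityʳ _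
boundsFrom-∷ʳ {suc n} c i (x ∷ xs) v rewrite boundsFrom-∷ʳ c (suc i) xs v | +-suc i n =
  sym (∧-assoc (x <ᵇ c * i) _ _)

isLehmer-∷ʳ : ∀ c (xs : Vec ℕ n) v → IsLehmer c (xs ∷ʳ v) ⇔ (IsLehmer c xs × T (v <ᵇ c * suc n))
isLehmer-∷ʳ {n} c xs v =
  subst (λ b → T b ⇔ (IsLehmer c xs × T (v <ᵇ c * suc n))) (sym (boundsFrom-∷ʳ c 1 xs v)) T-∧

lehmer-∷ʳ : ∀ c n → WeightedIso {Lehmer c n × Below (c * suc n)}
                                 (λ z → sum (proj₁ (proj₁ z)) + proj₁ (proj₂ z)) (λ ℓ → sum (proj₁ ℓ))
lehmer-∷ʳ c n = record
  { iso       = mk↔ₛ′ snoc unsnoc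
                  (λ ℓ → Σ-≡-irrelevant T-irrelevant (sym (proj₂ (proj₂ (initLast (proj₁ ℓ))))))
                  (λ z → cong₂ _,_ (Σ-≡-irrelevant T-irrelevant (init-∷ʳ _ (proj₁ (proj₁ z))))
                                   (Σ-≡-irrelevant T-irrelevant (last-∷ʳ _ (proj₁ (proj₁ z)))))
  ; weight-to = λ z → sum-∷ʳ (proj₁ (proj₁ z)) (proj₁ (proj₂ z))
  }
  where
  snoc : Lehmer c n × Below (c * suc n) → Lehmer c (suc n)
  snoc ((xs , xs-ok) , (v , v-ok)) = xs ∷ʳ v , Equivalence.from (isLehmer-∷ʳ c xs v) (xs-ok , v-ok)

  unsnoc : Lehmer c (suc n) → Lehmer c n × Below (c * suc n)
  unsnoc (xs , xs-ok) =
    let init-ok , last-ok = Equivalence.to (isLehmer-∷ʳ c (init xs) (last xs))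
                                           (subst (IsLehmer c) (proj₂ (proj₂ (initLast xs))) xs-ok)
    in (init xs , init-ok) , (last xs , last-ok)

≡ᵇ-comm : ∀ m n → (m ≡ᵇ n) ≡ (n ≡ᵇ m)
≡ᵇ-comm zero    zero    = refl
≡ᵇ-comm zero    (suc n) = refl
≡ᵇ-comm (suc m) zero    = refl
≡ᵇ-comm (suc m) (suc n) = ≡ᵇ-comm m n

toℕ-≡ᵇ-reflects-≡ : ∀ (x y : Fin m) → Reflects (x ≡ y) (toℕ x ≡ᵇ toℕ y)
toℕ-≡ᵇ-reflects-≡ x y = fromEquivalence (toℕ-injective ∘ ≡ᵇ⇒≡ _ _) (≡⇒≡ᵇ _ _ ∘ cong toℕ)

∈ᵇ-insertAt : ∀ (x : Fin m) (v : Vec (Fin m) k) p a → x ∈ᵇ insertAt v p a ≡ (toℕ x ≡ᵇ toℕ a) ∨ (x ∈ᵇ v)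
∈ᵇ-insertAt x v       zero    a = refl
∈ᵇ-insertAt x (y ∷ v) (suc p) a rewrite ∈ᵇ-insertAt x v p a =
  ∨-leftComm (toℕ x ≡ᵇ toℕ y) (toℕ x ≡ᵇ toℕ a) (x ∈ᵇ v)

distinct-insertAt : ∀ (v : Vec (Fin m) k) p a → distinct (insertAt v p a) ≡ not (a ∈ᵇ v) ∧ distinct v
distinct-insertAt v       zero    a = refl
distinct-insertAt (y ∷ v) (suc p) a
  rewrite ∈ᵇ-insertAt y v p a | distinct-insertAt v p a | ≡ᵇ-comm (toℕ y) (toℕ a) =
  swap (toℕ a ≡ᵇ toℕ y) (y ∈ᵇ v) (a ∈ᵇ v) (distinct v)
  where
  swap : ∀ b x y d → not (b ∨ x) ∧ (not y ∧ d) ≡ not (b ∨ y) ∧ (not x ∧ d)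
  swap true  x y d = refl
  swap false x y d = ∧-leftComm (not x) (not y) d

∈ᵇ-map-inject₁ : ∀ (x : Fin m) (v : Vec (Fin m) k) → inject₁ x ∈ᵇ map inject₁ v ≡ x ∈ᵇ v
∈ᵇ-map-inject₁ x []      = refl
∈ᵇ-map-inject₁ x (y ∷ v) rewrite toℕ-inject₁ x | toℕ-inject₁ y | ∈ᵇ-map-inject₁ x v = refl

distinct-map-inject₁ : ∀ (v : Vec (Fin m) k) → distinct (map inject₁ v) ≡ distinct v
distinct-map-inject₁ []      = refl
distinct-map-inject₁ (y ∷ v) rewrite ∈ᵇ-map-inject₁ y v | distinct-map-inject₁ v = refl

fromℕ-∉ᵇ-map-inject₁ : ∀ (v : Vec (Fin m) k) → fromℕ m ∈ᵇ map inject₁ v ≡ false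
fromℕ-∉ᵇ-map-inject₁ []          = refl
fromℕ-∉ᵇ-map-inject₁ {m} (y ∷ v)
  with toℕ (fromℕ m) ≡ᵇ toℕ (inject₁ y) | toℕ-≡ᵇ-reflects-≡ (fromℕ m) (inject₁ y)
... | true  | ofʸ max≡y = ⊥-elim (fromℕ≢inject₁ max≡y)
... | false | ofⁿ _     = fromℕ-∉ᵇ-map-inject₁ v

map-inject₁-injective : ∀ {u v : Vec (Fin m) k} → map inject₁ u ≡ map inject₁ v → u ≡ v
map-inject₁-injective {u = []}    {[]}    _  = refl
map-inject₁-injective {u = x ∷ u} {y ∷ v} eq =
  cong₂ _∷_ (inject₁-injective (proj₁ (∷-injective eq))) (map-inject₁-injective (proj₂ (∷-injective eq)))

insertMax : Vec (Fin m) k → Fin (suc k) → Vec (Fin (suc m)) (suc k)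
insertMax {m} v p = insertAt (map inject₁ v) p (fromℕ m)

distinct-insertMax : ∀ (v : Vec (Fin m) k) p → distinct (insertMax v p) ≡ distinct v
distinct-insertMax {m} v p
  rewrite distinct-insertAt (map inject₁ v) p (fromℕ m) | fromℕ-∉ᵇ-map-inject₁ v = distinct-map-inject₁ v

insertMax-injective : ∀ {u v : Vec (Fin m) k} {p q} → insertMax u p ≡ insertMax v q → p ≡ q × u ≡ v
insertMax-injective             {p = zero}  {zero}  eq =
  refl , map-inject₁-injective (proj₂ (∷-injective eq))
insertMax-injective {v = _ ∷ _} {p = zero}  {suc q} eq =
  ⊥-elim (fromℕ≢inject₁ (proj₁ (∷-injective eq)))
insertMax-injective {u = _ ∷ _} {p = suc p} {zero}  eq =
  ⊥-elim (fromℕ≢inject₁ (sym (proj₁ (∷-injective eq))))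
insertMax-injective {u = x ∷ u} {y ∷ v} {suc p} {suc q} eq
  with refl , u≡v ← insertMax-injective {u = u} {v} (proj₂ (∷-injective eq)) =
  refl , cong₂ _∷_ (inject₁-injective (proj₁ (∷-injective eq))) u≡v

∈ᵇ⇒insertAt : ∀ {a : Fin m} (v : Vec (Fin m) (suc k)) → T (a ∈ᵇ v) → ∃₂ λ p u → v ≡ insertAt u p a
∈ᵇ⇒insertAt {a = a} (y ∷ v) a∈v with toℕ a ≡ᵇ toℕ y | toℕ-≡ᵇ-reflects-≡ a y
∈ᵇ⇒insertAt (y ∷ v)     _   | true  | ofʸ refl = zero , v , refl
∈ᵇ⇒insertAt (y ∷ z ∷ v) a∈v | false | ofⁿ _    =
  let p , u , eq = ∈ᵇ⇒insertAt (z ∷ v) a∈v in suc p , y ∷ u , cong (y ∷_) eq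

∉ᵇ⇒map-inject₁ : ∀ (v : Vec (Fin (suc m)) k) → fromℕ m ∈ᵇ v ≡ false → ∃ λ u → v ≡ map inject₁ u
∉ᵇ⇒map-inject₁ []          _ = [] , refl
∉ᵇ⇒map-inject₁ {m} (y ∷ v) max∉v with toℕ (fromℕ m) ≡ᵇ toℕ y | toℕ-≡ᵇ-reflects-≡ (fromℕ m) y
... | false | ofⁿ y≢max =
  let u , eq = ∉ᵇ⇒map-inject₁ v max∉v in
  lower₁ y m≢y ∷ u , cong₂ _∷_ (sym (inject₁-lower₁ y m≢y)) eq
  where
  m≢y : m ≢ toℕ y
  m≢y m≡y = y≢max (toℕ-injective (trans (toℕ-fromℕ m) m≡y))

lower-distinct : ∀ (v : Vec (Fin (suc m)) k) → fromℕ m ∈ᵇ v ≡ false → T (distinct v) →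
                 Σ[ u ∈ Vec (Fin m) k ] v ≡ map inject₁ u × T (distinct u)
lower-distinct v max∉v v-distinct with u , refl ← ∉ᵇ⇒map-inject₁ v max∉v =
  u , refl , subst T (distinct-map-inject₁ u) v-distinct

lower-distinct-insertAt : ∀ (v : Vec (Fin (suc m)) k) p → T (distinct (insertAt v p (fromℕ m))) →
                        Σ[ u ∈ Vec (Fin m) k ] v ≡ map inject₁ u × T (distinct u)
lower-distinct-insertAt {m} v p w-distinct =
  let max∉v , v-distinct = Equivalence.to T-∧ (subst T (distinct-insertAt v p (fromℕ m)) w-distinct)
  in lower-distinct v (Equivalence.to T-not-≡ max∉v) v-distinct

data MaxView (w : Vec (Fin (suc m)) (suc k)) : Set where
  lowered  : (u : Vec (Fin m) (suc k)) → w ≡ map inject₁ u → T (distinct u) → MaxView w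
  inserted : (p : Fin (suc k)) (u : Vec (Fin m) k) → w ≡ insertMax u p → T (distinct u) → MaxView w

maxView : ∀ (w : Vec (Fin (suc m)) (suc k)) → T (distinct w) → MaxView w
maxView {m} w w-distinct with fromℕ m ∈ᵇ w in max∈w
... | false with u , w≡ , u-distinct ← lower-distinct w max∈w w-distinct = lowered u w≡ u-distinct
... | true with p , v , refl ← ∈ᵇ⇒insertAt w (subst T (sym max∈w) _) =
  let u , v≡ , u-distinct = lower-distinct-insertAt v p w-distinct
  in inserted p u (cong (λ x → insertAt x p (fromℕ m)) v≡) u-distinct

distinct-pigeonhole : ∀ (v : Vec (Fin n) (suc n)) → ¬ T (distinct v)
distinct-pigeonhole {zero}  (() ∷ _)
distinct-pigeonhole {suc n} v v-distinct with maxView v v-distinct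
... | lowered (_ ∷ u) _ u-distinct = distinct-pigeonhole u (proj₂ (Equivalence.to T-∧ u-distinct))
... | inserted _ u _ u-distinct    = distinct-pigeonhole u u-distinct

removeMax : ∀ (w : Vec (Fin (suc n)) (suc n)) → IsPerm w →
            Σ[ p ∈ Fin (suc n) ] Σ[ u ∈ Vec (Fin n) n ] w ≡ insertMax u p × IsPerm u
removeMax w w-perm with maxView w w-perm
... | lowered u _ u-distinct     = ⊥-elim (distinct-pigeonhole u u-distinct)
... | inserted p u w≡ u-distinct = p , u , w≡ , u-distinct

m<n⇒m<ᵇn≡true : m < n → (m <ᵇ n) ≡ true
m<n⇒m<ᵇn≡true {m} {n} m<n with m <ᵇ n | <ᵇ-reflects-< m n
... | true  | _        = refl
... | false | ofⁿ m≮n = ⊥-elim (m≮n m<n)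

m<n⇒n<ᵇm≡false : m < n → (n <ᵇ m) ≡ false
m<n⇒n<ᵇm≡false {m} {n} m<n with n <ᵇ m | <ᵇ-reflects-< n m
... | false | _       = refl
... | true  | ofʸ n<m = ⊥-elim (<-asym m<n n<m)

colorBonus : ∀ c → Fin c → ℕ
colorBonus c t = c * [ 0 <ᵇ toℕ t ]

insertionWeight : ∀ c n → Fin (suc n) × Fin c → ℕ
insertionWeight c n (p , t) = (n ∸ toℕ p) + toℕ p * colorBonus c t + toℕ t

pairTerm-inject₁ : ∀ (x y : Fin m) (t : Fin c) → pairTerm (inject₁ x) (inject₁ y) t ≡ pairTerm x y t
pairTerm-inject₁ x y t rewrite toℕ-inject₁ x | toℕ-inject₁ y = refl

pairTerm-fromℕ-inject₁ : ∀ (y : Fin m) (t : Fin c) → pairTerm (fromℕ m) (inject₁ y) t ≡ 1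
pairTerm-fromℕ-inject₁ {m} {c} y t
  rewrite toℕ-fromℕ m | toℕ-inject₁ y | m<n⇒m<ᵇn≡true (toℕ<n y) | m<n⇒n<ᵇm≡false (toℕ<n y) =
  cong suc (*-zeroʳ c)

pairTerm-inject₁-fromℕ : ∀ (x : Fin m) (t : Fin c) → pairTerm (inject₁ x) (fromℕ m) t ≡ colorBonus c t
pairTerm-inject₁-fromℕ {m} x t
  rewrite toℕ-fromℕ m | toℕ-inject₁ x | m<n⇒m<ᵇn≡true (toℕ<n x) | m<n⇒n<ᵇm≡false (toℕ<n x) = refl

pairsWith-map-inject₁ : ∀ (x : Fin m) (w : Vec (Fin m) k) (cs : Vec (Fin c) k) →
                        pairsWith (inject₁ x) (map inject₁ w) cs ≡ pairsWith x w cs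
pairsWith-map-inject₁ x []      []        = refl
pairsWith-map-inject₁ x (y ∷ w) (cy ∷ cs) = cong₂ _+_ (pairTerm-inject₁ x y cy) (pairsWith-map-inject₁ x w cs)

pairSum-map-inject₁ : ∀ (w : Vec (Fin m) k) (cs : Vec (Fin c) k) → pairSum (map inject₁ w) cs ≡ pairSum w cs
pairSum-map-inject₁ []      []        = refl
pairSum-map-inject₁ (y ∷ w) (cy ∷ cs) = cong₂ _+_ (pairsWith-map-inject₁ y w cs) (pairSum-map-inject₁ w cs)

pairsWith-fromℕ : ∀ (w : Vec (Fin m) k) (cs : Vec (Fin c) k) → pairsWith (fromℕ m) (map inject₁ w) cs ≡ k
pairsWith-fromℕ []      []        = refl
pairsWith-fromℕ (y ∷ w) (cy ∷ cs) = cong₂ _+_ (pairTerm-fromℕ-inject₁ y cy) (pairsWith-fromℕ w cs)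

pairsWith-insertAt : ∀ (x : Fin m) (v : Vec (Fin m) k) (cs : Vec (Fin c) k) p a t →
                     pairsWith x (insertAt v p a) (insertAt cs p t) ≡ pairTerm x a t + pairsWith x v cs
pairsWith-insertAt x v       cs        zero    a t = refl
pairsWith-insertAt x (y ∷ v) (cy ∷ cs) (suc p) a t rewrite pairsWith-insertAt x v cs p a t =
  +-leftComm (pairTerm x y cy) (pairTerm x a t) (pairsWith x v cs)

pairSum-insertMax : ∀ {c m k} (w : Vec (Fin m) k) (cs : Vec (Fin c) k) p t →
                    pairSum (insertMax w p) (insertAt cs p t)
                      ≡ pairSum w cs + ((k ∸ toℕ p) + toℕ p * colorBonus c t)
pairSum-insertMax {k = k} w cs zero t = begin
  pairsWith _ (map inject₁ w) cs + pairSum (map inject₁ w) cs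
    ≡⟨ cong₂ _+_ (pairsWith-fromℕ w cs) (pairSum-map-inject₁ w cs) ⟩
  k + pairSum w cs
    ≡⟨ +-comm k _ ⟩
  pairSum w cs + k
    ≡⟨ cong (pairSum w cs +_) (sym (+-identityʳ k)) ⟩
  pairSum w cs + (k + 0)  ∎
pairSum-insertMax {c} {m} {suc k} (y ∷ w) (cy ∷ cs) (suc p) t = begin
  pairsWith (inject₁ y) (insertMax w p) (insertAt cs p t) + pairSum (insertMax w p) (insertAt cs p t)
    ≡⟨ cong₂ _+_ (pairsWith-insertAt (inject₁ y) (map inject₁ w) cs p (fromℕ m) t)
                 (pairSum-insertMax w cs p t) ⟩
  (pairTerm (inject₁ y) (fromℕ m) t + pairsWith (inject₁ y) (map inject₁ w) cs)
    + (pairSum w cs + (d + toℕ p * b))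
    ≡⟨ cong (_+ (pairSum w cs + (d + toℕ p * b)))
            (cong₂ _+_ (pairTerm-inject₁-fromℕ y t) (pairsWith-map-inject₁ y w cs)) ⟩
  (b + pairsWith y w cs) + (pairSum w cs + (d + toℕ p * b))
    ≡⟨ regroup b (pairsWith y w cs) (pairSum w cs) d (toℕ p) ⟩
  (pairsWith y w cs + pairSum w cs) + (d + (b + toℕ p * b))  ∎
  where
  b d : ℕ
  b = colorBonus c t
  d = k ∸ toℕ p
  regroup : ∀ b x s d p → (b + x) + (s + (d + p * b)) ≡ (x + s) + (d + (b + p * b))
  regroup = solve-∀

colSum-insertAt : ∀ (cs : Vec (Fin c) k) p t → colSum (insertAt cs p t) ≡ toℕ t + colSum cs
colSum-insertAt cs        zero    t = refl
colSum-insertAt (cy ∷ cs) (suc p) t rewrite colSum-insertAt cs p t = +-leftComm (toℕ cy) (toℕ t) (colSum cs)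

colperm-≡ : ∀ {w w′ : Vec (Fin n) n} {cs cs′ : Vec (Fin c) n} {π π′} →
            w ≡ w′ → cs ≡ cs′ → colperm w cs π ≡ colperm w′ cs′ π′
colperm-≡ refl refl = cong (colperm _ _) (T-irrelevant _ _)

insertAt-injective : ∀ {u v : Vec A k} p {a b} → insertAt u p a ≡ insertAt v p b → u ≡ v × a ≡ b
insertAt-injective {u = u} {v} p {a} {b} eq =
  trans (sym (removeAt-insertAt u p a)) (trans (cong (λ x → removeAt x p) eq) (removeAt-insertAt v p b)) ,
  trans (sym (insertAt-lookup u p a)) (trans (cong (λ x → lookup x p) eq) (insertAt-lookup v p b))

module _ (c n : ℕ) where

  insertMaxColPerm : ColPerm c n × (Fin (suc n) × Fin c) → ColPerm c (suc n)
  insertMaxColPerm (colperm w cs π , p , t) =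
    colperm (insertMax w p) (insertAt cs p t) (subst T (sym (distinct-insertMax w p)) π)

  removeMaxColPerm : ColPerm c (suc n) → ColPerm c n × (Fin (suc n) × Fin c)
  removeMaxColPerm (colperm w cs π) =
    let p , u , _ , u-perm = removeMax w π in colperm u (removeAt cs p) u-perm , p , lookup cs p

  insert-remove : ∀ σ → insertMaxColPerm (removeMaxColPerm σ) ≡ σ
  insert-remove (colperm w cs π) =
    let p , u , w≡ , _ = removeMax w π in colperm-≡ (sym w≡) (insertAt-removeAt cs p)

  insertMaxColPerm-injective : ∀ {x y} → insertMaxColPerm x ≡ insertMaxColPerm y → x ≡ y
  insertMaxColPerm-injective {colperm w cs π , p , t} {colperm w′ cs′ π′ , p′ , t′} eq
    with refl , w≡w′ ← insertMax-injective (cong ColPerm.word eq)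
    with cs≡cs′ , refl ← insertAt-injective p (cong ColPerm.colors eq) =
    cong (_, p , t) (colperm-≡ w≡w′ cs≡cs′)

  remove-insert : ∀ z → removeMaxColPerm (insertMaxColPerm z) ≡ z
  remove-insert z = insertMaxColPerm-injective (insert-remove (insertMaxColPerm z))

  invc-insertMax : ∀ z → invc (insertMaxColPerm z) ≡ invc (proj₁ z) + insertionWeight c n (proj₂ z)
  invc-insertMax (colperm w cs π , p , t) = begin
    pairSum (insertMax w p) (insertAt cs p t) + colSum (insertAt cs p t)
      ≡⟨ cong₂ _+_ (pairSum-insertMax w cs p t) (colSum-insertAt cs p t) ⟩
    (pairSum w cs + ((n ∸ toℕ p) + toℕ p * colorBonus c t)) + (toℕ t + colSum cs)
      ≡⟨ regroup (pairSum w cs) (n ∸ toℕ p) (toℕ p * colorBonus c t) (toℕ t) (colSum cs) ⟩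
    (pairSum w cs + colSum cs) + ((n ∸ toℕ p) + toℕ p * colorBonus c t + toℕ t)  ∎
    where
    regroup : ∀ s d b t r → (s + (d + b)) + (t + r) ≡ (s + r) + (d + b + t)
    regroup = solve-∀

colPerm-insertMax : ∀ c n → WeightedIso (λ z → invc (proj₁ z) + insertionWeight c n (proj₂ z)) invc
colPerm-insertMax c n = record
  { iso       = mk↔ₛ′ (insertMaxColPerm c n) (removeMaxColPerm c n) (insert-remove c n) (remove-insert c n)
  ; weight-to = invc-insertMax c n
  }

module _ (c′ n : ℕ) where
  private
    swap-* : suc n * c′ ≡ c′ * suc n
    swap-* = *-comm (suc n) c′

  encodeDigit : Fin (suc n) × Fin (suc c′) → Fin (suc c′ * suc n)
  encodeDigit (p , zero)  = opposite p ↑ˡ (c′ * suc n)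
  encodeDigit (p , suc s) = suc n ↑ʳ cast swap-* (combine p s)

  decodeDigit : Fin (suc c′ * suc n) → Fin (suc n) × Fin (suc c′)
  decodeDigit i with splitAt (suc n) i
  ... | inj₁ j = opposite j , zero
  ... | inj₂ j = map₂ suc (remQuot c′ (cast (sym swap-*) j))

  encode-decode : ∀ i → encodeDigit (decodeDigit i) ≡ i
  encode-decode i with splitAt (suc n) i in eq
  ... | inj₁ j = trans (cong (_↑ˡ (c′ * suc n)) (opposite-involutive j)) (splitAt⁻¹-↑ˡ eq)
  ... | inj₂ j = trans (cong (suc n ↑ʳ_) cast-combine-remQuot) (splitAt⁻¹-↑ʳ eq)
    where
    cast-combine-remQuot : cast swap-* (uncurry (combine {suc n} {c′}) (remQuot c′ (cast (sym swap-*) j))) ≡ j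
    cast-combine-remQuot = trans (cong (cast swap-*) (combine-remQuot c′ (cast (sym swap-*) j)))
                                 (cast-involutive swap-* (sym swap-*) j)

  decode-encode : ∀ d → decodeDigit (encodeDigit d) ≡ d
  decode-encode (p , zero) rewrite splitAt-↑ˡ (suc n) (opposite p) (c′ * suc n) =
    cong (_, zero) (opposite-involutive p)
  decode-encode (p , suc s)
    rewrite splitAt-↑ʳ (suc n) (c′ * suc n) (cast swap-* (combine p s))
          | cast-involutive (sym swap-*) swap-* (combine p s) =
    cong (map₂ suc) (remQuot-combine p s)

  toℕ-encodeDigit : ∀ d → toℕ (encodeDigit d) ≡ insertionWeight (suc c′) n d
  toℕ-encodeDigit (p , zero) = begin
    toℕ (opposite p ↑ˡ (c′ * suc n))
      ≡⟨ trans (toℕ-↑ˡ (opposite p) _) (opposite-prop p) ⟩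
    n ∸ toℕ p
      ≡⟨ uncolored (n ∸ toℕ p) (toℕ p) (suc c′) ⟩
    insertionWeight (suc c′) n (p , zero)  ∎
    where
    uncolored : ∀ d p c → d ≡ d + p * (c * 0) + 0
    uncolored = solve-∀
  toℕ-encodeDigit (p , suc s) = begin
    toℕ (suc n ↑ʳ cast swap-* (combine p s))
      ≡⟨ toℕ-↑ʳ (suc n) _ ⟩
    suc n + toℕ (cast swap-* (combine p s))
      ≡⟨ cong (suc n +_) (trans (toℕ-cast swap-* _) (toℕ-combine p s)) ⟩
    suc n + (c′ * toℕ p + toℕ s)
      ≡⟨ cong (λ m → suc m + (c′ * toℕ p + toℕ s)) (sym (m+[n∸m]≡n (≤-pred (toℕ<n p)))) ⟩
    suc (toℕ p + (n ∸ toℕ p)) + (c′ * toℕ p + toℕ s)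
      ≡⟨ colored (toℕ p) (n ∸ toℕ p) (toℕ s) c′ ⟩
    insertionWeight (suc c′) n (p , suc s)  ∎
    where
    colored : ∀ p d s c′ → suc (p + d) + (c′ * p + s) ≡ d + p * (suc c′ * 1) + suc s
    colored = solve-∀

digits : ∀ c n → WeightedIso {Fin (suc n) × Fin c} (insertionWeight c n) (toℕ {c * suc n})
digits zero     n = record
  { iso       = mk↔ₛ′ (λ { (_ , ()) }) (λ ()) (λ ()) (λ { (_ , ()) })
  ; weight-to = λ { (_ , ()) }
  }
digits (suc c′) n = record
  { iso       = mk↔ₛ′ (encodeDigit c′ n) (decodeDigit c′ n) (encode-decode c′ n) (decode-encode c′ n)
  ; weight-to = toℕ-encodeDigit c′ n
  }

lehmer≅colPerm : ∀ c n → WeightedIso {Lehmer c n} (λ ℓ → sum (proj₁ ℓ)) invc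
lehmer≅colPerm c zero = record
  { iso       = mk↔ₛ′ (λ _ → colperm [] [] tt) (λ _ → [] , tt)
                      (λ { (colperm [] [] tt) → refl }) (λ { ([] , tt) → refl })
  ; weight-to = λ { ([] , _) → refl }
  }
lehmer≅colPerm c (suc n) =
  symʷ (lehmer-∷ʳ c n)
  ⨾ʷ lehmer≅colPerm c n ×ʷ (below↔Fin (c * suc n) ⨾ʷ symʷ (digits c n))
  ⨾ʷ colPerm-insertMax c n

theorem2p2 : (n c k : ℕ) → 1 ≤ n → 1 ≤ c → LehmerClass c n k ↔ InvClass c n k
theorem2p2 n c k _ _ = ↔-trans (↔-sym Σ-assoc) (fibre-↔ (lehmer≅colPerm c n) k)
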